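{- Let $X,Y$ be sets and consider multirelations $X\leftrightarrow\mathcal{P}Y$. (1) On the set of inner deterministic multirelations, $\sqsubseteq_\downarrow$ coincides with $\subseteq$ and $\sqsubseteq_\uparrow$ coincides with $\supseteq$; hence $\sqsubseteq_\updownarrow$ is the discrete order (equality) there. (2) $\sqsubseteq_\updownarrow$ is a partial order on the set of inner univalent multirelations. (3) $\sqsubseteq_\downarrow$, $\sqsubseteq_\uparrow$ and $\sqsubseteq_\updownarrow$ are partial orders on the set of outer univalent multirelations. (4) $\sqsubseteq_\downarrow$, $\sqsubseteq_\uparrow$ and $\sqsubseteq_\updownarrow$ coincide on the set of outer deterministic multirelations.
   Context: A multirelation is a relation $R\subseteq X\times\mathcal{P}Y$. Inner closures: $\uparrow R=\{(a,A)\mid\exists B.\,(a,B)\in R\wedge B\subseteq A\}$, $\downarrow R=\{(a,A)\mid\exists B.\,(a,B)\in R\wedge A\subseteq B\}$. Preorders: $R\sqsubseteq_\uparrow S\Leftrightarrow S\subseteq\uparrow R$; $R\sqsubseteq_\downarrow S\Leftrightarrow R\subseteq\downarrow S$; $R\sqsubseteq_\updownarrow S\Leftrightarrow R\sqsubseteq_\downarrow S\wedge R\sqsubseteq_\uparrow S$. $R$ is inner univalent if every $B$ with $(a,B)\in R$ is empty or a singleton, inner deterministic if every such $B$ is a singleton; outer univalent if each $a\in X$ is related to at most one set, outer deterministic if each $a\in X$ is related to exactly one set. -}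

module Defs where

open import Level using (0ℓ)
open import Data.Product using (Σ; ∃; _×_; _,_; proj₁)
open import Data.Sum using (_⊎_)
open import Relation.Unary using (Pred; _⊆_; _≐_; Empty; ｛_｝)
open import Relation.Binary.Structures using (IsPartialOrder)

𝒫 : Set → Set₁
𝒫 Y = Pred Y 0ℓ

-- A multirelation X ↔ 𝒫Y: a relation between X and 𝒫Y. Since elements of 𝒫Y
-- are sets, membership must respect extensional equality of sets.
record Multirel (X Y : Set) : Set₁ where
  constructor mkMultirel
  field
    rel : X → 𝒫 Y → Set
    ext : ∀ {a A B} → A ≐ B → rel a A → rel a B
open Multirel public

module _ {X Y : Set} where

  _⊆ᴹ_ : Multirel X Y → Multirel X Y → Set₁
  R ⊆ᴹ S = ∀ a A → rel R a A → rel S a A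

  _≈ᴹ_ : Multirel X Y → Multirel X Y → Set₁
  R ≈ᴹ S = (R ⊆ᴹ S) × (S ⊆ᴹ R)

  ↑ : Multirel X Y → X → 𝒫 Y → Set₁
  ↑ R a A = ∃ λ (B : 𝒫 Y) → rel R a B × B ⊆ A

  ↓ : Multirel X Y → X → 𝒫 Y → Set₁
  ↓ R a A = ∃ λ (B : 𝒫 Y) → rel R a B × A ⊆ B

  _⊑↑_ : Multirel X Y → Multirel X Y → Set₁
  R ⊑↑ S = ∀ a A → rel S a A → ↑ R a A

  _⊑↓_ : Multirel X Y → Multirel X Y → Set₁
  R ⊑↓ S = ∀ a A → rel R a A → ↓ S a A

  _⊑↕_ : Multirel X Y → Multirel X Y → Set₁
  R ⊑↕ S = (R ⊑↓ S) × (R ⊑↑ S)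

  IsSingleton : 𝒫 Y → Set
  IsSingleton B = ∃ λ y → B ≐ ｛ y ｝

  InnerUnivalent : Multirel X Y → Set₁
  InnerUnivalent R = ∀ a B → rel R a B → Empty B ⊎ IsSingleton B

  InnerDeterministic : Multirel X Y → Set₁
  InnerDeterministic R = ∀ a B → rel R a B → IsSingleton B

  OuterUnivalent : Multirel X Y → Set₁
  OuterUnivalent R = ∀ a B C → rel R a B → rel R a C → B ≐ C

  OuterDeterministic : Multirel X Y → Set₁
  OuterDeterministic R = OuterUnivalent R × (∀ a → ∃ λ (B : 𝒫 Y) → rel R a B)

  Sub : (Multirel X Y → Set₁) → Set₁
  Sub P = Σ (Multirel X Y) P

  on : {P : Multirel X Y → Set₁} →
       (Multirel X Y → Multirel X Y → Set₁) → Sub P → Sub P → Set₁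
  on _∼_ R S = proj₁ R ∼ proj₁ S

  IsPartialOrderOn : (Multirel X Y → Set₁) →
                     (Multirel X Y → Multirel X Y → Set₁) → Set₁
  IsPartialOrderOn P _∼_ = IsPartialOrder (on {P} _≈ᴹ_) (on {P} _∼_)

{-# OPTIONS --safe #-}
module Submission where

-- A nonempty set contained in a set that is
-- empty or a singleton equals it, and a set contained in an empty set is
-- empty; this forces the witnesses of the inner closures to be the set itself
-- for inner univalent multirelations. For outer univalent ones a round trip
-- A ⊆ B ⊆ C through S returns to the unique set C = A of R, sandwiching B.
-- For outer deterministic R and S, both ⊑↓ and ⊑↑ say that the unique set of
-- R at each point is contained in the unique set of S there.

open import Defs
open import Data.Empty using (⊥-elim)
open import Data.Product using (∃; _×_; _,_; proj₁; proj₂; map)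
open import Data.Sum using (_⊎_; inj₁; inj₂)
open import Function.Base using (_∘_; id)
open import Function.Bundles using (_⇔_; mk⇔)
open import Relation.Binary.PropositionalEquality using (refl; subst; trans; sym)
open import Relation.Binary.Structures using (IsEquivalence)
open import Relation.Unary using (_≐_; _⊆_; Empty; Satisfiable; ｛_｝)
open import Relation.Unary.Properties using (⊆-antisym; ≐-sym)

module _ {Y : Set} where

  ⊆-univalent⇒≐ : {A B : 𝒫 Y} → Satisfiable A → Empty B ⊎ (∃ λ z → B ≐ ｛ z ｝) →
                  A ⊆ B → A ≐ B
  ⊆-univalent⇒≐ (y , y∈A) (inj₁ B-empty) A⊆B = ⊥-elim (B-empty y (A⊆B y∈A))
  ⊆-univalent⇒≐ {A} {B} (y , y∈A) (inj₂ (z , B⊆z , _)) A⊆B = A⊆B , B⊆A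
    where
    B⊆A : B ⊆ A
    B⊆A w∈B = subst A (trans (sym (B⊆z (A⊆B y∈A))) (B⊆z w∈B)) y∈A

  singleton-satisfiable : {B : 𝒫 Y} → (∃ λ z → B ≐ ｛ z ｝) → Satisfiable B
  singleton-satisfiable (z , _ , z⊆B) = z , z⊆B refl

  ⊆-empty⇒≐ : {A B : 𝒫 Y} → Empty B → A ⊆ B → A ≐ B
  ⊆-empty⇒≐ B-empty A⊆B = A⊆B , λ {w} w∈B → ⊥-elim (B-empty w w∈B)

module _ {X Y : Set} where

  ↓-innerUnivalent : (S : Multirel X Y) → InnerUnivalent S → ∀ {a A} →
                     Satisfiable A → ↓ S a A → rel S a A
  ↓-innerUnivalent S S-iu A-sat (B , a∈SB , A⊆B) =
    ext S (≐-sym (⊆-univalent⇒≐ A-sat (S-iu _ B a∈SB) A⊆B)) a∈SB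

  ↑-innerDeterministic : (R : Multirel X Y) → InnerDeterministic R → ∀ {a A} →
                         Empty A ⊎ IsSingleton {X} A → ↑ R a A → rel R a A
  ↑-innerDeterministic R R-id A-iu (B , a∈RB , B⊆A) =
    ext R (⊆-univalent⇒≐ (singleton-satisfiable (R-id _ B a∈RB)) A-iu B⊆A) a∈RB

  ↑-empty : (R : Multirel X Y) → ∀ {a A} → Empty A → ↑ R a A → rel R a A
  ↑-empty R A-empty (B , a∈RB , B⊆A) = ext R (⊆-empty⇒≐ A-empty B⊆A) a∈RB

  ⊆ᴹ⇒⊑↓ : (R S : Multirel X Y) → R ⊆ᴹ S → R ⊑↓ S
  ⊆ᴹ⇒⊑↓ R S R⊆S a A a∈RA = A , R⊆S a A a∈RA , id

  ⊇ᴹ⇒⊑↑ : (R S : Multirel X Y) → S ⊆ᴹ R → R ⊑↑ S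
  ⊇ᴹ⇒⊑↑ R S S⊆R a A a∈SA = A , S⊆R a A a∈SA , id

  ≈ᴹ⇒⊑↕ : (R S : Multirel X Y) → R ≈ᴹ S → R ⊑↕ S
  ≈ᴹ⇒⊑↕ R S (R⊆S , S⊆R) = ⊆ᴹ⇒⊑↓ R S R⊆S , ⊇ᴹ⇒⊑↑ R S S⊆R

  ⊑↓-trans : (R S T : Multirel X Y) → R ⊑↓ S → S ⊑↓ T → R ⊑↓ T
  ⊑↓-trans R S T R⊑S S⊑T a A a∈RA with R⊑S a A a∈RA
  ... | B , a∈SB , A⊆B with S⊑T a B a∈SB
  ... | C , a∈TC , B⊆C = C , a∈TC , B⊆C ∘ A⊆B

  ⊑↑-trans : (R S T : Multirel X Y) → R ⊑↑ S → S ⊑↑ T → R ⊑↑ T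
  ⊑↑-trans R S T R⊑S S⊑T a A a∈TA with S⊑T a A a∈TA
  ... | B , a∈SB , B⊆A with R⊑S a B a∈SB
  ... | C , a∈RC , C⊆B = C , a∈RC , B⊆A ∘ C⊆B

  ⊑↕-trans : (R S T : Multirel X Y) → R ⊑↕ S → S ⊑↕ T → R ⊑↕ T
  ⊑↕-trans R S T (R⊑↓S , R⊑↑S) (S⊑↓T , S⊑↑T) =
    ⊑↓-trans R S T R⊑↓S S⊑↓T , ⊑↑-trans R S T R⊑↑S S⊑↑T

  ≈ᴹ-isEquivalence : {P : Multirel X Y → Set₁} →
                     IsEquivalence (on {X} {Y} {P} _≈ᴹ_)
  ≈ᴹ-isEquivalence = record
    { refl  = (λ _ _ → id) , (λ _ _ → id)
    ; sym   = λ (R⊆S , S⊆R) → S⊆R , R⊆S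
    ; trans = λ (R⊆S , S⊆R) (S⊆T , T⊆S) →
        (λ a A → S⊆T a A ∘ R⊆S a A) , (λ a A → S⊆R a A ∘ T⊆S a A)
    }

  isPartialOrderOn : {P : Multirel X Y → Set₁}
                     {_∼_ : Multirel X Y → Multirel X Y → Set₁} →
                     (∀ R S → R ≈ᴹ S → R ∼ S) →
                     (∀ R S T → R ∼ S → S ∼ T → R ∼ T) →
                     (∀ R S → P R → P S → R ∼ S → S ∼ R → R ⊆ᴹ S) →
                     IsPartialOrderOn P _∼_
  isPartialOrderOn {P} ∼-reflexive ∼-trans ∼-antisym-⊆ᴹ = record
    { isPreorder = record
      { isEquivalence = ≈ᴹ-isEquivalence {P = P}
      ; reflexive     = λ {(R , _)} {(S , _)} → ∼-reflexive R S
      ; trans         = λ {(R , _)} {(S , _)} {(T , _)} → ∼-trans R S T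
      }
    ; antisym = λ {(R , pR)} {(S , pS)} R∼S S∼R →
        ∼-antisym-⊆ᴹ R S pR pS R∼S S∼R , ∼-antisym-⊆ᴹ S R pS pR S∼R R∼S
    }

  innerDeterministic⇒innerUnivalent : (R : Multirel X Y) →
                                      InnerDeterministic R → InnerUnivalent R
  innerDeterministic⇒innerUnivalent R R-id a B a∈RB = inj₂ (R-id a B a∈RB)

  ⊑↓⇒⊆ᴹ : (R S : Multirel X Y) → InnerDeterministic R → InnerUnivalent S →
          R ⊑↓ S → R ⊆ᴹ S
  ⊑↓⇒⊆ᴹ R S R-id S-iu R⊑S a A a∈RA =
    ↓-innerUnivalent S S-iu (singleton-satisfiable (R-id a A a∈RA)) (R⊑S a A a∈RA)

  ⊑↑⇒⊇ᴹ : (R S : Multirel X Y) → InnerDeterministic R → InnerUnivalent S →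
          R ⊑↑ S → S ⊆ᴹ R
  ⊑↑⇒⊇ᴹ R S R-id S-iu R⊑S a A a∈SA =
    ↑-innerDeterministic R R-id (S-iu a A a∈SA) (R⊑S a A a∈SA)

  innerDeterministic-orders : (R S : Multirel X Y) →
    InnerDeterministic R → InnerDeterministic S →
    ((R ⊑↓ S) ⇔ (R ⊆ᴹ S)) × ((R ⊑↑ S) ⇔ (S ⊆ᴹ R)) × ((R ⊑↕ S) ⇔ (R ≈ᴹ S))
  innerDeterministic-orders R S R-id S-id =
      mk⇔ ⊑↓⇒⊆ᴹ′ (⊆ᴹ⇒⊑↓ R S)
    , mk⇔ ⊑↑⇒⊇ᴹ′ (⊇ᴹ⇒⊑↑ R S)
    , mk⇔ (map ⊑↓⇒⊆ᴹ′ ⊑↑⇒⊇ᴹ′) (≈ᴹ⇒⊑↕ R S)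
    where
    S-iu : InnerUnivalent S
    S-iu = innerDeterministic⇒innerUnivalent S S-id
    ⊑↓⇒⊆ᴹ′ : R ⊑↓ S → R ⊆ᴹ S
    ⊑↓⇒⊆ᴹ′ = ⊑↓⇒⊆ᴹ R S R-id S-iu
    ⊑↑⇒⊇ᴹ′ : R ⊑↑ S → S ⊆ᴹ R
    ⊑↑⇒⊇ᴹ′ = ⊑↑⇒⊇ᴹ R S R-id S-iu

  -- An empty set of R is recovered from a witness below it, a singleton from
  -- a witness above it.
  ⊑↕-antisym-innerUnivalent : (R S : Multirel X Y) → InnerUnivalent R →
                              InnerUnivalent S → R ⊑↕ S → S ⊑↕ R → R ⊆ᴹ S
  ⊑↕-antisym-innerUnivalent R S R-iu S-iu (R⊑↓S , _) (_ , S⊑↑R) a A a∈RA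
    with R-iu a A a∈RA
  ... | inj₁ A-empty = ↑-empty S A-empty (S⊑↑R a A a∈RA)
  ... | inj₂ A-single =
    ↓-innerUnivalent S S-iu (singleton-satisfiable A-single) (R⊑↓S a A a∈RA)

  ⊑↓-antisym-outerUnivalent : (R S : Multirel X Y) → OuterUnivalent R →
                              R ⊑↓ S → S ⊑↓ R → R ⊆ᴹ S
  ⊑↓-antisym-outerUnivalent R S R-ou R⊑S S⊑R a A a∈RA
    with R⊑S a A a∈RA
  ... | B , a∈SB , A⊆B with S⊑R a B a∈SB
  ... | C , a∈RC , B⊆C =
    ext S (≐-sym (⊆-antisym A⊆B (proj₂ (R-ou a A C a∈RA a∈RC) ∘ B⊆C))) a∈SB

  ⊑↑-antisym-outerUnivalent : (R S : Multirel X Y) → OuterUnivalent R →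
                              R ⊑↑ S → S ⊑↑ R → R ⊆ᴹ S
  ⊑↑-antisym-outerUnivalent R S R-ou R⊑S S⊑R a A a∈RA
    with S⊑R a A a∈RA
  ... | B , a∈SB , B⊆A with R⊑S a B a∈SB
  ... | C , a∈RC , C⊆B =
    ext S (⊆-antisym B⊆A (C⊆B ∘ proj₁ (R-ou a A C a∈RA a∈RC))) a∈SB

  OuterTotal : Multirel X Y → Set₁
  OuterTotal R = ∀ a → ∃ λ (B : 𝒫 Y) → rel R a B

  ⊑↓⇒⊑↑ : (R S : Multirel X Y) → OuterTotal R → OuterUnivalent S →
          R ⊑↓ S → R ⊑↑ S
  ⊑↓⇒⊑↑ R S R-total S-ou R⊑S a A a∈SA with R-total a
  ... | B , a∈RB with R⊑S a B a∈RB
  ... | C , a∈SC , B⊆C = B , a∈RB , proj₁ (S-ou a C A a∈SC a∈SA) ∘ B⊆C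

  ⊑↑⇒⊑↓ : (R S : Multirel X Y) → OuterUnivalent R → OuterTotal S →
          R ⊑↑ S → R ⊑↓ S
  ⊑↑⇒⊑↓ R S R-ou S-total R⊑S a A a∈RA with S-total a
  ... | B , a∈SB with R⊑S a B a∈SB
  ... | C , a∈RC , C⊆B = B , a∈SB , C⊆B ∘ proj₁ (R-ou a A C a∈RA a∈RC)

  outerDeterministic-orders : (R S : Multirel X Y) →
    OuterDeterministic R → OuterDeterministic S →
    ((R ⊑↓ S) ⇔ (R ⊑↑ S)) × ((R ⊑↓ S) ⇔ (R ⊑↕ S))
  outerDeterministic-orders R S (R-ou , R-total) (S-ou , S-total) =
      mk⇔ ⊑↓⇒⊑↑′ (⊑↑⇒⊑↓ R S R-ou S-total)
    , mk⇔ (λ R⊑S → R⊑S , ⊑↓⇒⊑↑′ R⊑S) proj₁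
    where
    ⊑↓⇒⊑↑′ : R ⊑↓ S → R ⊑↑ S
    ⊑↓⇒⊑↑′ = ⊑↓⇒⊑↑ R S R-total S-ou

proposition5p8 : {X Y : Set} →
    -- (1)
    ((R S : Multirel X Y) → InnerDeterministic R → InnerDeterministic S →
      ((R ⊑↓ S) ⇔ (R ⊆ᴹ S)) × ((R ⊑↑ S) ⇔ (S ⊆ᴹ R)) × ((R ⊑↕ S) ⇔ (R ≈ᴹ S)))
    -- (2)
    × IsPartialOrderOn {X} {Y} InnerUnivalent _⊑↕_
    -- (3)
    × IsPartialOrderOn {X} {Y} OuterUnivalent _⊑↓_
    × IsPartialOrderOn {X} {Y} OuterUnivalent _⊑↑_
    × IsPartialOrderOn {X} {Y} OuterUnivalent _⊑↕_
    -- (4)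
    × ((R S : Multirel X Y) → OuterDeterministic R → OuterDeterministic S →
      ((R ⊑↓ S) ⇔ (R ⊑↑ S)) × ((R ⊑↓ S) ⇔ (R ⊑↕ S)))
proposition5p8 =
    innerDeterministic-orders
  , isPartialOrderOn ≈ᴹ⇒⊑↕ ⊑↕-trans ⊑↕-antisym-innerUnivalent
  , isPartialOrderOn (λ R S → ⊆ᴹ⇒⊑↓ R S ∘ proj₁) ⊑↓-trans
      (λ R S R-ou _ → ⊑↓-antisym-outerUnivalent R S R-ou)
  , isPartialOrderOn (λ R S → ⊇ᴹ⇒⊑↑ R S ∘ proj₂) ⊑↑-trans
      (λ R S R-ou _ → ⊑↑-antisym-outerUnivalent R S R-ou)
  , isPartialOrderOn ≈ᴹ⇒⊑↕ ⊑↕-trans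
      (λ R S R-ou _ R⊑S S⊑R →
        ⊑↓-antisym-outerUnivalent R S R-ou (proj₁ R⊑S) (proj₁ S⊑R))
  , outerDeterministic-orders
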